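{- Let $n\geq 4$ and let ${}_{n}w=[n,1,2,\dots,n-4,n-2,n-1,n-3]\in\mathfrak{S}_n$ (i.e. ${}_{n}w(1)=n$, ${}_{n}w(i)=i-1$ for $2\leq i\leq n-3$, ${}_{n}w(n-2)=n-2$, ${}_{n}w(n-1)=n-1$, ${}_{n}w(n)=n-3$). Then every reduced word $\mathbf{a}=a_1a_2\cdots a_{n+1}$ of ${}_{n}w$ has exactly $2$ ascents and exactly $n-2$ descents.
   Context: $s_i\in\mathfrak{S}_n$ ($1\leq i\leq n-1$) is the simple transposition exchanging $i$ and $i+1$. Permutations are composed as functions, $(uv)(i)=u(v(i))$. A reduced word of $w$ is a sequence $a_1\cdots a_p$ with $w=s_{a_1}s_{a_2}\cdots s_{a_p}$ and $p=\ell(w)$, the number of inversions of $w$ (here $\ell({}_{n}w)=n+1$). The ascent set of $\mathbf{a}$ is $\{j: a_j<a_{j+1}\}$ and the descent set is $\{j: a_j>a_{j+1}\}$; the numbers of ascents/descents are the sizes of these sets. -}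

module Defs where

open import Data.Nat using (ℕ; zero; suc; _+_; _∸_; _≤_; _<_)
open import Data.Nat.Properties using (_≟_; _<?_)
open import Data.Bool using (Bool; true; false; if_then_else_)
open import Data.List using (List; []; _∷_; length)
open import Data.List.Relation.Unary.All using (All)
open import Data.Product using (_×_)
open import Relation.Nullary using (does)
open import Relation.Binary.PropositionalEquality using (_≡_)

-- Permutations of {1,…,n} are represented as functions ℕ → ℕ (1-based);
-- only their values on 1..n matter.

s : ℕ → ℕ → ℕ
s i x = if does (x ≟ i) then suc i else (if does (x ≟ suc i) then i else x)

prod : List ℕ → ℕ → ℕ
prod [] x = x
prod (a ∷ as) x = s a (prod as x)

count : ℕ → (ℕ → Bool) → ℕ
count zero P = zero
count (suc m) P = (if P (suc m) then 1 else 0) + count m P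

total : ℕ → (ℕ → ℕ) → ℕ
total zero f = zero
total (suc m) f = f (suc m) + total m f

inversions : ℕ → (ℕ → ℕ) → ℕ
inversions n w = total n (λ j → count (j ∸ 1) (λ i → does (w j <? w i)))

IsReducedWord : ℕ → (ℕ → ℕ) → List ℕ → Set
IsReducedWord n w a =
  All (λ i → 1 ≤ i × i < n) a
  × (∀ x → 1 ≤ x → x ≤ n → prod a x ≡ w x)
  × length a ≡ inversions n w

ascents : List ℕ → ℕ
ascents [] = 0
ascents (x ∷ []) = 0
ascents (x ∷ y ∷ r) = (if does (x <? y) then 1 else 0) + ascents (y ∷ r)

descents : List ℕ → ℕ
descents [] = 0
descents (x ∷ []) = 0
descents (x ∷ y ∷ r) = (if does (y <? x) then 1 else 0) + descents (y ∷ r)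

wn : ℕ → ℕ → ℕ
wn n x =
  if does (x ≟ 1) then n
  else if does (x ≟ n) then n ∸ 3
  else if does (x ≟ n ∸ 2) then n ∸ 2
  else if does (x ≟ n ∸ 1) then n ∸ 1
  else x ∸ 1

-- If c ∷ r is a reduced word of u, then c is a left descent of u: the value c + 1 occurs to the
-- left of c. When u increases on the positions 2, …, n - 1 this forces u(1) = c + 1 or u(n) = c,
-- and the product of r again increases there. Peeling letters off the left of the word therefore
-- yields, for every such u with α = u(1) and β = u(n),
--   ascents + [β ≤ first letter] = n - β   and   ℓ(u) = (α - 1) + (n - β) - [β < α].
-- For ₙw we have α = n and β = n - 3, so a reduced word has 2 ascents and n + 1 letters; as a reduced
-- word never repeats a letter twice in a row, the remaining n - 2 gaps are descents.
module Submission where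

open import Defs
open import Data.Nat using (ℕ; zero; suc; _+_; _∸_; _≤_; _<_; z≤n; s≤s)
open import Data.Nat.Properties
open import Data.Bool using (Bool; true; false; if_then_else_)
open import Data.List using (List; []; _∷_; length)
open import Data.List.Relation.Unary.All using (All; []; _∷_)
open import Data.List.Relation.Unary.Linked using (Linked; []; [-]; _∷_)
open import Data.Product using (_×_; _,_; proj₁; proj₂)
open import Data.Sum using (_⊎_; inj₁; inj₂; [_,_]′)
open import Data.Empty using (⊥-elim)
open import Function using (id; _∘_)
open import Function.Definitions using (Injective)
open import Relation.Nullary using (¬_; Dec; does; yes; no)
open import Relation.Nullary.Decidable using (dec-true; dec-false)
open import Relation.Binary.PropositionalEquality
open import Relation.Binary.Definitions using (tri<; tri≈; tri>)
open import Algebra.Properties.CommutativeSemigroup +-commutativeSemigroup using (interchange)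
open ≡-Reasoning

s-self : ∀ c → s c c ≡ suc c
s-self c rewrite dec-true (c ≟ c) refl = refl

s-suc : ∀ c → s c (suc c) ≡ c
s-suc c rewrite dec-false (suc c ≟ c) 1+n≢n | dec-true (suc c ≟ suc c) refl = refl

s-other : ∀ {c x} → x ≢ c → x ≢ suc c → s c x ≡ x
s-other {c} {x} x≢c x≢1+c rewrite dec-false (x ≟ c) x≢c | dec-false (x ≟ suc c) x≢1+c = refl

data S-View (c x : ℕ) : Set where
  at-c     : x ≡ c → s c x ≡ suc c → S-View c x
  at-suc-c : x ≡ suc c → s c x ≡ c → S-View c x
  fixed    : x ≢ c → x ≢ suc c → s c x ≡ x → S-View c x

s-view : ∀ c x → S-View c x
s-view c x with x ≟ c | x ≟ suc c
... | yes refl | _        = at-c refl (s-self x)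
... | no x≢c   | yes refl = at-suc-c refl (s-suc c)
... | no x≢c   | no x≢1+c = fixed x≢c x≢1+c (s-other x≢c x≢1+c)

s-involutive : ∀ c x → s c (s c x) ≡ x
s-involutive c x with s-view c x
... | at-c refl e       = trans (cong (s c) e) (s-suc c)
... | at-suc-c refl e   = trans (cong (s c) e) (s-self c)
... | fixed _ _ e       = trans (cong (s c) e) e

s-injective : ∀ c → Injective _≡_ _≡_ (s c)
s-injective c {x} {y} e = trans (sym (s-involutive c x)) (trans (cong (s c) e) (s-involutive c y))

s≡suc⇒≡ : ∀ {c x} → s c x ≡ suc c → x ≡ c
s≡suc⇒≡ {c} e = s-injective c (trans e (sym (s-self c)))

s≡⇒≡suc : ∀ {c x} → s c x ≡ c → x ≡ suc c
s≡⇒≡suc {c} e = s-injective c (trans e (sym (s-suc c)))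

s-fixes : ∀ {c x} → s c x ≢ c → s c x ≢ suc c → s c x ≡ x
s-fixes {c} {x} ≢c ≢1+c with s-view c x
... | at-c _ e       = ⊥-elim (≢1+c e)
... | at-suc-c _ e   = ⊥-elim (≢c e)
... | fixed _ _ e    = e

s-monotone : ∀ c {x y} → x < y → ¬ (x ≡ c × y ≡ suc c) → s c x < s c y
s-monotone c {x} {y} x<y not-swapped with s-view c x | s-view c y
... | at-c refl _     | at-c refl _     = ⊥-elim (<-irrefl refl x<y)
... | at-c refl _     | at-suc-c refl _ = ⊥-elim (not-swapped (refl , refl))
... | at-c refl e     | fixed _ y≢1+c f rewrite e | f = ≤∧≢⇒< x<y (λ p → y≢1+c (sym p))
... | at-suc-c refl _ | at-c refl _     = ⊥-elim (<-asym x<y (n<1+n c))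
... | at-suc-c refl _ | at-suc-c refl _ = ⊥-elim (<-irrefl refl x<y)
... | at-suc-c refl e | fixed _ _ f rewrite e | f = <-trans (n<1+n c) x<y
... | fixed _ _ e     | at-c refl f rewrite e | f = <-trans x<y (n<1+n c)
... | fixed x≢c _ e   | at-suc-c refl f rewrite e | f = ≤∧≢⇒< (≤-pred x<y) x≢c
... | fixed _ _ e     | fixed _ _ f rewrite e | f = x<y

Letter : ℕ → ℕ → Set
Letter n i = 1 ≤ i × i < n

InRange : ℕ → ℕ → Set
InRange n x = 1 ≤ x × x ≤ n

s-inRange : ∀ {n c x} → Letter n c → InRange n x → InRange n (s c x)
s-inRange {n} {c} {x} (1≤c , c<n) x∈ with s-view c x
... | at-c _ e       rewrite e = s≤s z≤n , c<n
... | at-suc-c _ e   rewrite e = 1≤c , <⇒≤ c<n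
... | fixed _ _ e    rewrite e = x∈

prod⁻¹ : List ℕ → ℕ → ℕ
prod⁻¹ [] y = y
prod⁻¹ (c ∷ r) y = prod⁻¹ r (s c y)

prod∘prod⁻¹ : ∀ r y → prod r (prod⁻¹ r y) ≡ y
prod∘prod⁻¹ [] y = refl
prod∘prod⁻¹ (c ∷ r) y = trans (cong (s c) (prod∘prod⁻¹ r (s c y))) (s-involutive c y)

prod-injective : ∀ r → Injective _≡_ _≡_ (prod r)
prod-injective [] e = e
prod-injective (c ∷ r) e = prod-injective r (s-injective c e)

prod₁≢prodₙ : ∀ {n} r → 2 ≤ n → prod r 1 ≢ prod r n
prod₁≢prodₙ r 2≤n e = <⇒≢ 2≤n (prod-injective r e)

prod⁻¹-inRange : ∀ {n r y} → All (Letter n) r → InRange n y → InRange n (prod⁻¹ r y)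
prod⁻¹-inRange [] y∈ = y∈
prod⁻¹-inRange (c∈ ∷ r∈) y∈ = prod⁻¹-inRange r∈ (s-inRange c∈ y∈)

-- The summands of ascents and descents are literally χ (x <? y), which reduces to χ (suc x ≤? y).
χ : ∀ {p} {P : Set p} → Dec P → ℕ
χ d = if does d then 1 else 0

χ-true : ∀ {p} {P : Set p} (d : Dec P) → P → χ d ≡ 1
χ-true d p = cong (λ b → if b then 1 else 0) (dec-true d p)

χ-false : ∀ {p} {P : Set p} (d : Dec P) → ¬ P → χ d ≡ 0
χ-false d ¬p = cong (λ b → if b then 1 else 0) (dec-false d ¬p)

χ<+χ> : ∀ {x y} → x ≢ y → χ (x <? y) + χ (y <? x) ≡ 1
χ<+χ> {x} {y} x≢y with <-cmp x y
... | tri< x<y _ _ = cong₂ _+_ (χ-true (x <? y) x<y) (χ-false (y <? x) (<-asym x<y))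
... | tri≈ _ x≡y _ = ⊥-elim (x≢y x≡y)
... | tri> _ _ y<x = cong₂ _+_ (χ-false (x <? y) (<-asym y<x)) (χ-true (y <? x) y<x)

χ≤+χ< : ∀ x y → χ (y ≤? x) + χ (x <? y) ≡ 1
χ≤+χ< x y with <-≤-connex x y
... | inj₁ x<y = cong₂ _+_ (χ-false (y ≤? x) (<⇒≱ x<y)) (χ-true (x <? y) x<y)
... | inj₂ y≤x = cong₂ _+_ (χ-true (y ≤? x) y≤x) (χ-false (x <? y) (≤⇒≯ y≤x))

χ≤≡χ< : ∀ {x y} → x ≢ y → χ (x ≤? y) ≡ χ (x <? y)
χ≤≡χ< {x} {y} x≢y with <-≤-connex x y
... | inj₁ x<y = trans (χ-true (x ≤? y) (<⇒≤ x<y)) (sym (χ-true (x <? y) x<y))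
... | inj₂ y≤x = trans (χ-false (x ≤? y) (λ x≤y → x≢y (≤-antisym x≤y y≤x)))
                      (sym (χ-false (x <? y) (≤⇒≯ y≤x)))

χ≤suc≡χ≤ : ∀ {x y} → x ≢ suc y → χ (x ≤? suc y) ≡ χ (x ≤? y)
χ≤suc≡χ≤ {x} {y} x≢1+y with ≤-<-connex x y
... | inj₁ x≤y = trans (χ-true (x ≤? suc y) (m≤n⇒m≤1+n x≤y)) (sym (χ-true (x ≤? y) x≤y))
... | inj₂ y<x = trans (χ-false (x ≤? suc y) (λ x≤1+y → x≢1+y (≤-antisym x≤1+y y<x)))
                      (sym (χ-false (x ≤? y) (<⇒≱ y<x)))

count-cong : ∀ m {P Q : ℕ → Bool} → (∀ i → InRange m i → P i ≡ Q i) → count m P ≡ count m Q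
count-cong zero eq = refl
count-cong (suc m) eq =
  cong₂ _+_ (cong (λ b → if b then 1 else 0) (eq (suc m) (s≤s z≤n , ≤-refl)))
            (count-cong m (λ i (1≤i , i≤m) → eq i (1≤i , m≤n⇒m≤1+n i≤m)))

count-suc : ∀ m {P Q : ℕ → Bool} i₀ → InRange m i₀ → P i₀ ≡ false → Q i₀ ≡ true →
  (∀ i → InRange m i → i ≢ i₀ → P i ≡ Q i) → count m Q ≡ suc (count m P)
count-suc zero i₀ (() , z≤n)
count-suc (suc m) i₀ (1≤i₀ , i₀≤1+m) Pi₀ Qi₀ eq with i₀ ≟ suc m
... | yes refl rewrite Pi₀ | Qi₀ =
  cong suc (sym (count-cong m (λ i (1≤i , i≤m) → eq i (1≤i , m≤n⇒m≤1+n i≤m) (λ e → <-irrefl e (s≤s i≤m)))))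
... | no i₀≢1+m =
  trans (cong₂ _+_ (cong (λ b → if b then 1 else 0)
                         (sym (eq (suc m) (s≤s z≤n , ≤-refl) (λ e → i₀≢1+m (sym e)))))
                   (count-suc m i₀ (1≤i₀ , ≤-pred (≤∧≢⇒< i₀≤1+m i₀≢1+m)) Pi₀ Qi₀
                      (λ i (1≤i , i≤m) → eq i (1≤i , m≤n⇒m≤1+n i≤m))))
        (+-suc _ _)

total-cong : ∀ n {f g : ℕ → ℕ} → (∀ j → InRange n j → f j ≡ g j) → total n f ≡ total n g
total-cong zero eq = refl
total-cong (suc n) eq =
  cong₂ _+_ (eq (suc n) (s≤s z≤n , ≤-refl)) (total-cong n (λ j (1≤j , j≤n) → eq j (1≤j , m≤n⇒m≤1+n j≤n)))

total-suc : ∀ n {f g : ℕ → ℕ} j₀ → InRange n j₀ → g j₀ ≡ suc (f j₀) →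
  (∀ j → InRange n j → j ≢ j₀ → f j ≡ g j) → total n g ≡ suc (total n f)
total-suc zero j₀ (() , z≤n)
total-suc (suc n) {f} j₀ (1≤j₀ , j₀≤1+n) gj₀ eq with j₀ ≟ suc n
... | yes refl rewrite gj₀ =
  cong suc (cong (f (suc n) +_)
    (sym (total-cong n (λ j (1≤j , j≤n) → eq j (1≤j , m≤n⇒m≤1+n j≤n) (λ e → <-irrefl e (s≤s j≤n))))))
... | no j₀≢1+n =
  trans (cong₂ _+_ (sym (eq (suc n) (s≤s z≤n , ≤-refl) (λ e → j₀≢1+n (sym e))))
                   (total-suc n j₀ (1≤j₀ , ≤-pred (≤∧≢⇒< j₀≤1+n j₀≢1+n)) gj₀
                      (λ j (1≤j , j≤n) → eq j (1≤j , m≤n⇒m≤1+n j≤n))))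
        (+-suc _ _)

count-false : ∀ m → count m (λ _ → false) ≡ 0
count-false zero = refl
count-false (suc m) = count-false m

total-zero : ∀ n → total n (λ _ → 0) ≡ 0
total-zero zero = refl
total-zero (suc n) = total-zero n

≤∸1⇒< : ∀ {i j} → 1 ≤ j → i ≤ j ∸ 1 → i < j
≤∸1⇒< {j = suc j} _ i≤j = s≤s i≤j

<⇒≤∸1 : ∀ {i j} → i < j → i ≤ j ∸ 1
<⇒≤∸1 (s≤s i≤j) = i≤j

inversions-cong : ∀ n {u v : ℕ → ℕ} → (∀ x → InRange n x → u x ≡ v x) → inversions n u ≡ inversions n v
inversions-cong n eq = total-cong n (λ j (1≤j , j≤n) → count-cong (j ∸ 1) (λ i (1≤i , i≤j-1) →
  cong₂ (λ a b → does (a <? b)) (eq j (1≤j , j≤n)) (eq i (1≤i , ≤-trans (<⇒≤ (≤∸1⇒< 1≤j i≤j-1)) j≤n))))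

inversions-id : ∀ n → inversions n (λ x → x) ≡ 0
inversions-id n = trans
  (total-cong n (λ j (1≤j , _) → trans
    (count-cong (j ∸ 1) (λ i (_ , i≤j-1) → dec-false (j <? i) (<-asym (≤∸1⇒< 1≤j i≤j-1))))
    (count-false (j ∸ 1))))
  (total-zero n)

inversions-suc : ∀ n (u v : ℕ → ℕ) {lo hi} → 1 ≤ lo → lo < hi → hi ≤ n → u lo < u hi → v hi < v lo →
  (∀ {i j} → 1 ≤ i → i < j → j ≤ n → ¬ (i ≡ lo × j ≡ hi) → does (u j <? u i) ≡ does (v j <? v i)) →
  inversions n v ≡ suc (inversions n u)
inversions-suc n u v {lo} {hi} 1≤lo lo<hi hi≤n ulo<uhi vhi<vlo agree =
  total-suc n hi (1≤hi , hi≤n)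
    (count-suc (hi ∸ 1) lo (1≤lo , <⇒≤∸1 lo<hi)
       (dec-false (u hi <? u lo) (<-asym ulo<uhi)) (dec-true (v hi <? v lo) vhi<vlo)
       (λ i (1≤i , i≤hi-1) i≢lo → agree 1≤i (≤∸1⇒< 1≤hi i≤hi-1) hi≤n (λ (i≡lo , _) → i≢lo i≡lo)))
    (λ j (1≤j , j≤n) j≢hi → count-cong (j ∸ 1) (λ i (1≤i , i≤j-1) →
       agree 1≤i (≤∸1⇒< 1≤j i≤j-1) j≤n (λ (_ , j≡hi) → j≢hi j≡hi)))
  where
  1≤hi : 1 ≤ hi
  1≤hi = ≤-trans 1≤lo (<⇒≤ lo<hi)

s-preserves-order : ∀ c {x y} → x ≢ y → ¬ (x ≡ c × y ≡ suc c) → ¬ (y ≡ c × x ≡ suc c) →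
  does (y <? x) ≡ does (s c y <? s c x)
s-preserves-order c {x} {y} x≢y ¬xy ¬yx with <-cmp x y
... | tri< x<y _ _ = trans (dec-false (y <? x) (<-asym x<y))
                          (sym (dec-false (s c y <? s c x) (<-asym (s-monotone c x<y ¬xy))))
... | tri≈ _ x≡y _ = ⊥-elim (x≢y x≡y)
... | tri> _ _ y<x = trans (dec-true (y <? x) y<x) (sym (dec-true (s c y <? s c x) (s-monotone c y<x ¬yx)))

inversions-s-ascend : ∀ n {u : ℕ → ℕ} {c lo hi} → Injective _≡_ _≡_ u → u lo ≡ c → u hi ≡ suc c →
  1 ≤ lo → lo < hi → hi ≤ n → inversions n (λ x → s c (u x)) ≡ suc (inversions n u)
inversions-s-ascend n {u} {c} {lo} {hi} u-inj ulo uhi 1≤lo lo<hi hi≤n =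
  inversions-suc n u (λ x → s c (u x)) 1≤lo lo<hi hi≤n
    (subst₂ _<_ (sym ulo) (sym uhi) (n<1+n c))
    (subst₂ _<_ (sym (trans (cong (s c) uhi) (s-suc c))) (sym (trans (cong (s c) ulo) (s-self c))) (n<1+n c))
    (λ _ i<j _ not-lo-hi → s-preserves-order c
       (λ e → <-irrefl (u-inj e) i<j)
       (λ (ui , uj) → not-lo-hi (u-inj (trans ui (sym ulo)) , u-inj (trans uj (sym uhi))))
       (λ (uj , ui) → <-asym lo<hi (subst₂ _<_ (u-inj (trans ui (sym uhi))) (u-inj (trans uj (sym ulo))) i<j)))

inversions-s-descend : ∀ n {u : ℕ → ℕ} {c lo hi} → Injective _≡_ _≡_ u → u lo ≡ suc c → u hi ≡ c →
  1 ≤ lo → lo < hi → hi ≤ n → suc (inversions n (λ x → s c (u x))) ≡ inversions n u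
inversions-s-descend n {u} {c} u-inj ulo uhi 1≤lo lo<hi hi≤n =
  trans (sym (inversions-s-ascend n (λ e → u-inj (s-injective c e))
               (trans (cong (s c) ulo) (s-suc c)) (trans (cong (s c) uhi) (s-self c)) 1≤lo lo<hi hi≤n))
        (inversions-cong n (λ x _ → s-involutive c (u x)))

inversions-s∘prod : ∀ {n c r} → Letter n c → All (Letter n) r →
  (prod⁻¹ r c < prod⁻¹ r (suc c) × inversions n (prod (c ∷ r)) ≡ suc (inversions n (prod r)))
  ⊎ suc (inversions n (prod (c ∷ r))) ≡ inversions n (prod r)
inversions-s∘prod {n} {c} {r} (1≤c , c<n) r∈
  with <-cmp (prod⁻¹ r c) (prod⁻¹ r (suc c))
     | prod⁻¹-inRange r∈ (1≤c , <⇒≤ c<n) | prod⁻¹-inRange r∈ (s≤s z≤n , c<n)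
... | tri< P<Q _ _ | 1≤P , _ | _ , Q≤n = inj₁ (P<Q ,
  inversions-s-ascend n (prod-injective r) (prod∘prod⁻¹ r c) (prod∘prod⁻¹ r (suc c)) 1≤P P<Q Q≤n)
... | tri≈ _ P≡Q _ | _ | _ = ⊥-elim (1+n≢n (sym
  (trans (sym (prod∘prod⁻¹ r c)) (trans (cong (prod r) P≡Q) (prod∘prod⁻¹ r (suc c))))))
... | tri> _ _ Q<P | _ , P≤n | 1≤Q , _ = inj₂
  (inversions-s-descend n (prod-injective r) (prod∘prod⁻¹ r (suc c)) (prod∘prod⁻¹ r c) 1≤Q Q<P P≤n)

inversions≤length : ∀ {n} r → All (Letter n) r → inversions n (prod r) ≤ length r
inversions≤length {n} [] [] = ≤-reflexive (inversions-id n)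
inversions≤length (c ∷ r) (c∈ ∷ r∈) with inversions-s∘prod c∈ r∈
... | inj₁ (_ , up) = ≤-trans (≤-reflexive up) (s≤s (inversions≤length r r∈))
... | inj₂ down = m≤n⇒m≤1+n (≤-trans (n≤1+n _) (≤-trans (≤-reflexive down) (inversions≤length r r∈)))

Reduced : ℕ → List ℕ → Set
Reduced n r = All (Letter n) r × length r ≡ inversions n (prod r)

-- The second component says that c is a left descent of prod (c ∷ r): the value c + 1 occurs left of c.
reduced-tail : ∀ {n c r} → Reduced n (c ∷ r) →
  Reduced n r × prod⁻¹ (c ∷ r) (suc c) < prod⁻¹ (c ∷ r) c
reduced-tail {n} {c} {r} (c∈ ∷ r∈ , len) with inversions-s∘prod c∈ r∈
... | inj₁ (P<Q , up) = (r∈ , suc-injective (trans len up)) ,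
  subst₂ (λ a b → prod⁻¹ r a < prod⁻¹ r b) (sym (s-suc c)) (sym (s-self c)) P<Q
... | inj₂ down = ⊥-elim (1+n≰n (≤-trans (n≤1+n _)
  (≤-trans (≤-reflexive (trans (cong suc len) down)) (inversions≤length r r∈))))

reduced-no-square : ∀ {n c r} → ¬ Reduced n (c ∷ c ∷ r)
reduced-no-square {c = c} {r} red = <-asym (proj₂ (reduced-tail (proj₁ (reduced-tail red))))
  (subst₂ (λ a b → prod⁻¹ (c ∷ r) a < prod⁻¹ (c ∷ r) b) (s-suc c) (s-self c) (proj₂ (reduced-tail red)))

reduced-linked : ∀ {n r} → Reduced n r → Linked _≢_ r
reduced-linked {r = []} _ = []
reduced-linked {r = c ∷ []} _ = [-]
reduced-linked {r = c ∷ d ∷ r} red =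
  (λ { refl → reduced-no-square red }) ∷ reduced-linked (proj₁ (reduced-tail red))

ascents+descents : ∀ {r} → Linked _≢_ r → ascents r + descents r ≡ length r ∸ 1
ascents+descents [] = refl
ascents+descents [-] = refl
ascents+descents {x ∷ y ∷ t} (x≢y ∷ linked) = begin
  (χ (x <? y) + ascents (y ∷ t)) + (χ (y <? x) + descents (y ∷ t))
    ≡⟨ interchange (χ (x <? y)) (ascents (y ∷ t)) (χ (y <? x)) (descents (y ∷ t)) ⟩
  (χ (x <? y) + χ (y <? x)) + (ascents (y ∷ t) + descents (y ∷ t))
    ≡⟨ cong₂ _+_ (χ<+χ> x≢y) (ascents+descents linked) ⟩
  suc (length t) ∎

InteriorIncreasing : ℕ → (ℕ → ℕ) → Set
InteriorIncreasing n u = ∀ {x y} → 2 ≤ x → x < y → y < n → u x < u y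

interiorIncreasing-cong : ∀ {n} {u v : ℕ → ℕ} → (∀ x → InRange n x → u x ≡ v x) →
  InteriorIncreasing n v → InteriorIncreasing n u
interiorIncreasing-cong u≗v inc 2≤x x<y y<n = subst₂ _<_
  (sym (u≗v _ (≤-trans (n≤1+n 1) 2≤x , <⇒≤ (<-trans x<y y<n))))
  (sym (u≗v _ (≤-trans (n≤1+n 1) (≤-trans 2≤x (<⇒≤ x<y)) , <⇒≤ y<n)))
  (inc 2≤x x<y y<n)

Admissible : ℕ → List ℕ → Set
Admissible n r = Reduced n r × InteriorIncreasing n (prod r)

admissible-tail : ∀ {n c r} → Admissible n (c ∷ r) → Admissible n r
admissible-tail {n} {c} {r} (red , inc) = proj₁ (reduced-tail red) , inc′
  where
  position-of : ∀ v {z} → prod (c ∷ r) z ≡ v → z ≡ prod⁻¹ (c ∷ r) v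
  position-of v e = prod-injective (c ∷ r) (trans e (sym (prod∘prod⁻¹ (c ∷ r) v)))
  inc′ : InteriorIncreasing n (prod r)
  inc′ {x} {y} 2≤x x<y y<n = subst₂ _<_ (s-involutive c (prod r x)) (s-involutive c (prod r y))
    (s-monotone c (inc 2≤x x<y y<n) λ (ux≡c , uy≡1+c) → <-asym (proj₂ (reduced-tail red))
      (subst₂ _<_ (position-of c ux≡c) (position-of (suc c) uy≡1+c) x<y))

-- Since c + 1 occurs left of c but prod (c ∷ r) increases on {2, …, n - 1}, one of them sits at an end.
first-letter : ∀ {n c r} → Admissible n (c ∷ r) → prod (c ∷ r) 1 ≡ suc c ⊎ prod (c ∷ r) n ≡ c
first-letter {n} {c} {r} (red@((1≤c , c<n) ∷ _ , _) , inc)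
  with prod⁻¹ (c ∷ r) (suc c) ≟ 1 | prod⁻¹ (c ∷ r) c ≟ n
     | prod⁻¹-inRange (proj₁ red) (s≤s z≤n , c<n) | prod⁻¹-inRange (proj₁ red) (1≤c , <⇒≤ c<n)
... | yes p≡1 | _ | _ | _ = inj₁ (subst (λ z → prod (c ∷ r) z ≡ suc c) p≡1 (prod∘prod⁻¹ (c ∷ r) (suc c)))
... | no _ | yes q≡n | _ | _ = inj₂ (subst (λ z → prod (c ∷ r) z ≡ c) q≡n (prod∘prod⁻¹ (c ∷ r) c))
... | no p≢1 | no q≢n | 1≤p , _ | _ , q≤n = ⊥-elim (<-asym (n<1+n c)
  (subst₂ _<_ (prod∘prod⁻¹ (c ∷ r) (suc c)) (prod∘prod⁻¹ (c ∷ r) c)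
    (inc (≤∧≢⇒< 1≤p (λ e → p≢1 (sym e))) (proj₂ (reduced-tail red)) (≤∧≢⇒< q≤n q≢n))))

Ends : ℕ → List ℕ → ℕ → ℕ → Set
Ends n r α β = prod r 1 ≡ α × prod r n ≡ β

swap-at-start : ∀ {n c r β} → 2 ≤ n → Admissible n (c ∷ r) → prod (c ∷ r) n ≡ β → β ≢ c → Ends n r c β
swap-at-start {n} {c} {r} 2≤n adm uₙ≡β β≢c = s≡suc⇒≡ u₁≡1+c , trans (sym (s-fixes uₙ≢c uₙ≢1+c)) uₙ≡β
  where
  uₙ≢c : prod (c ∷ r) n ≢ c
  uₙ≢c uₙ≡c = β≢c (trans (sym uₙ≡β) uₙ≡c)
  u₁≡1+c : prod (c ∷ r) 1 ≡ suc c
  u₁≡1+c = [ id , (λ uₙ≡c → ⊥-elim (uₙ≢c uₙ≡c)) ]′ (first-letter adm)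
  uₙ≢1+c : prod (c ∷ r) n ≢ suc c
  uₙ≢1+c uₙ≡1+c = prod₁≢prodₙ (c ∷ r) 2≤n (trans u₁≡1+c (sym uₙ≡1+c))

swap-at-end : ∀ {n c α} r → 2 ≤ n → Ends n (c ∷ r) α c → α ≢ suc c → Ends n r α (suc c)
swap-at-end {n} {c} r 2≤n (u₁≡α , uₙ≡c) α≢1+c = trans (sym (s-fixes u₁≢c u₁≢1+c)) u₁≡α , s≡⇒≡suc uₙ≡c
  where
  u₁≢c : prod (c ∷ r) 1 ≢ c
  u₁≢c u₁≡c = prod₁≢prodₙ (c ∷ r) 2≤n (trans u₁≡c (sym uₙ≡c))
  u₁≢1+c : prod (c ∷ r) 1 ≢ suc c
  u₁≢1+c u₁≡1+c = α≢1+c (trans (sym u₁≡α) u₁≡1+c)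

χ≤head : ℕ → List ℕ → ℕ
χ≤head β [] = 0
χ≤head β (h ∷ _) = χ (β ≤? h)

ascents-cons : ∀ c r → ascents (c ∷ r) ≡ χ≤head (suc c) r + ascents r
ascents-cons c [] = refl
ascents-cons c (h ∷ t) = refl

χ≤head-shift : ∀ {n c β} r → 2 ≤ n → Admissible n r → Ends n r c β → β ≢ c →
  χ (β ≤? c) + χ≤head (suc c) r ≡ χ≤head β r
χ≤head-shift {n} [] 2≤n _ (refl , refl) _ = trans (+-identityʳ _) (χ-false (n ≤? 1) (<⇒≱ 2≤n))
χ≤head-shift {c = c} {β} (h ∷ t) _ adm (v₁≡c , vₙ≡β) β≢c with first-letter adm
... | inj₁ v₁≡1+h with trans (sym v₁≡c) v₁≡1+h
...   | refl = trans (cong₂ _+_ (χ≤suc≡χ≤ β≢c) (χ-false (suc (suc h) ≤? h) (<⇒≱ (m<n⇒m<1+n (n<1+n h)))))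
                     (+-identityʳ _)
χ≤head-shift {c = c} {β} (h ∷ t) _ adm (_ , vₙ≡β) β≢c | inj₂ vₙ≡h with trans (sym vₙ≡β) vₙ≡h
...   | refl = trans (χ≤+χ< c β) (sym (χ-true (β ≤? β) ≤-refl))

ascents-formula : ∀ {n β} r → 2 ≤ n → Admissible n r → prod r n ≡ β → χ≤head β r + ascents r ≡ n ∸ β
ascents-formula {n} [] _ _ refl = sym (n∸n≡0 n)
ascents-formula {n} {β} (c ∷ r) 2≤n adm@(((_ , c<n) ∷ _ , _) , _) uₙ≡β with β ≟ c
... | yes refl = begin
  χ (c ≤? c) + ascents (c ∷ r)        ≡⟨ cong₂ _+_ (χ-true (c ≤? c) ≤-refl) (ascents-cons c r) ⟩
  suc (χ≤head (suc c) r + ascents r)  ≡⟨ cong suc (ascents-formula r 2≤n adm′ (s≡⇒≡suc uₙ≡β)) ⟩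
  suc (n ∸ suc c)                     ≡⟨ sym (+-∸-assoc 1 c<n) ⟩
  n ∸ c                               ∎
  where adm′ = admissible-tail adm
... | no β≢c = begin
  χ (β ≤? c) + ascents (c ∷ r)                ≡⟨ cong (χ (β ≤? c) +_) (ascents-cons c r) ⟩
  χ (β ≤? c) + (χ≤head (suc c) r + ascents r) ≡⟨ sym (+-assoc (χ (β ≤? c)) (χ≤head (suc c) r) (ascents r)) ⟩
  χ (β ≤? c) + χ≤head (suc c) r + ascents r   ≡⟨ cong (_+ ascents r) (χ≤head-shift r 2≤n adm′ ends β≢c) ⟩
  χ≤head β r + ascents r                       ≡⟨ ascents-formula r 2≤n adm′ (proj₂ ends) ⟩
  n ∸ β                                        ∎
  where
  adm′ = admissible-tail adm
  ends = swap-at-start 2≤n adm uₙ≡β β≢c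

length-formula : ∀ {n α β} r → 2 ≤ n → Admissible n r → Ends n r α β →
  suc (length r) + χ (β <? α) ≡ α + (n ∸ β)
length-formula {n} [] 2≤n _ (refl , refl) =
  cong suc (trans (χ-false (n <? 1) (λ n<1 → <⇒≱ 2≤n (<⇒≤ n<1))) (sym (n∸n≡0 n)))
length-formula {n} {α} {β} (c ∷ r) 2≤n adm@(((_ , c<n) ∷ _ , _) , _) ends@(u₁≡α , uₙ≡β)
  with α ≟ suc c | β ≟ c
... | yes refl | yes refl = begin
  suc (suc L) + χ (c <? suc c)        ≡⟨ cong (suc (suc L) +_) (χ-true (c <? suc c) (n<1+n c)) ⟩
  suc (suc L) + 1                     ≡⟨ cong (suc ∘ suc) (+-suc L 0) ⟩
  suc (suc (suc L + 0))               ≡⟨ cong (λ x → suc (suc (suc L + x))) (sym (χ-false (suc c <? c) c≮c)) ⟩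
  suc (suc (suc L + χ (suc c <? c)))  ≡⟨ cong (suc ∘ suc) (length-formula r 2≤n adm′ ends′) ⟩
  suc (suc (c + (n ∸ suc c)))         ≡⟨ cong suc (sym (+-suc c (n ∸ suc c))) ⟩
  suc c + suc (n ∸ suc c)             ≡⟨ cong (suc c +_) (sym (+-∸-assoc 1 c<n)) ⟩
  suc c + (n ∸ c)                     ∎
  where
  L = length r
  adm′ = admissible-tail adm
  ends′ = s≡suc⇒≡ u₁≡α , s≡⇒≡suc uₙ≡β
  c≮c : ¬ suc c < c
  c≮c = <-asym (n<1+n c)
... | yes refl | no β≢c = begin
  suc (suc L) + χ (β <? suc c)        ≡⟨ cong (suc (suc L) +_) (χ≤suc≡χ≤ (β≢c ∘ suc-injective)) ⟩
  suc (suc L + χ (β <? c))            ≡⟨ cong suc (length-formula r 2≤n adm′ ends′) ⟩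
  suc c + (n ∸ β)                     ∎
  where
  L = length r
  adm′ = admissible-tail adm
  ends′ = swap-at-start 2≤n adm uₙ≡β β≢c
... | no α≢1+c | yes refl = begin
  suc (suc L) + χ (c <? α)            ≡⟨ cong (suc (suc L) +_) (χ≤≡χ< (α≢1+c ∘ sym)) ⟩
  suc (suc L + χ (suc c <? α))        ≡⟨ cong suc (length-formula r 2≤n adm′ ends′) ⟩
  suc (α + (n ∸ suc c))               ≡⟨ sym (+-suc α (n ∸ suc c)) ⟩
  α + suc (n ∸ suc c)                 ≡⟨ cong (α +_) (sym (+-∸-assoc 1 c<n)) ⟩
  α + (n ∸ c)                         ∎
  where
  L = length r
  adm′ = admissible-tail adm
  ends′ = swap-at-end r 2≤n ends α≢1+c
... | no α≢1+c | no β≢c = ⊥-elim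
  ([ (λ e → α≢1+c (trans (sym u₁≡α) e)) , (λ e → β≢c (trans (sym uₙ≡β) e)) ]′ (first-letter adm))

χ≤head-descending : ∀ {n} r → 2 ≤ n → Admissible n r → prod r n < prod r 1 → χ≤head (prod r n) r ≡ 1
χ≤head-descending {n} [] 2≤n _ n<1 = ⊥-elim (<⇒≱ 2≤n (<⇒≤ n<1))
χ≤head-descending {n} (h ∷ t) _ adm uₙ<u₁ with first-letter adm
... | inj₁ u₁≡1+h = χ-true (prod (h ∷ t) n ≤? h) (≤-pred (subst (prod (h ∷ t) n <_) u₁≡1+h uₙ<u₁))
... | inj₂ uₙ≡h = χ-true (prod (h ∷ t) n ≤? h) (≤-reflexive uₙ≡h)

ascents-descending : ∀ {n} r → 2 ≤ n → Admissible n r → prod r n < prod r 1 →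
  suc (ascents r) ≡ n ∸ prod r n
ascents-descending r 2≤n adm uₙ<u₁ =
  trans (cong (_+ ascents r) (sym (χ≤head-descending r 2≤n adm uₙ<u₁))) (ascents-formula r 2≤n adm refl)

length-descending : ∀ {n} r → 2 ≤ n → Admissible n r → prod r n < prod r 1 →
  suc (suc (length r)) ≡ prod r 1 + (n ∸ prod r n)
length-descending {n} r 2≤n adm uₙ<u₁ = begin
  suc (suc (length r))                       ≡⟨ +-comm 1 (suc (length r)) ⟩
  suc (length r) + 1
    ≡⟨ cong (suc (length r) +_) (sym (χ-true (prod r n <? prod r 1) uₙ<u₁)) ⟩
  suc (length r) + χ (prod r n <? prod r 1)  ≡⟨ length-formula r 2≤n adm (refl , refl) ⟩
  prod r 1 + (n ∸ prod r n)                  ∎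

wn-last : ∀ m → wn (4 + m) (4 + m) ≡ suc m
wn-last m rewrite dec-true (4 + m ≟ 4 + m) refl = refl

wn-low : ∀ m {x} → 2 ≤ x → x ≤ suc m → wn (4 + m) x ≡ x ∸ 1
wn-low m {x} 2≤x x≤1+m
  rewrite dec-false (x ≟ 1) (λ e → <-irrefl (sym e) 2≤x)
        | dec-false (x ≟ 4 + m) (λ e → <-irrefl e (≤-trans (s≤s x≤1+m) (≤-trans (n≤1+n _) (n≤1+n _))))
        | dec-false (x ≟ 2 + m) (λ e → <-irrefl e (s≤s x≤1+m))
        | dec-false (x ≟ 3 + m) (λ e → <-irrefl e (≤-trans (s≤s x≤1+m) (n≤1+n _))) = refl

wn-high : ∀ m {x} → suc m < x → x < 4 + m → wn (4 + m) x ≡ x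
wn-high m {x} 1+m<x x<4+m with x ≟ 2 + m
... | yes refl rewrite dec-false (2 + m ≟ 4 + m) (λ e → <-irrefl e (n≤1+n _))
                     | dec-true (2 + m ≟ 2 + m) refl = refl
... | no x≢2+m rewrite ≤-antisym (≤-pred x<4+m) (≤∧≢⇒< 1+m<x (λ e → x≢2+m (sym e)))
                     | dec-false (3 + m ≟ 4 + m) (λ e → <-irrefl e ≤-refl)
                     | dec-false (3 + m ≟ 2 + m) 1+n≢n
                     | dec-true (3 + m ≟ 3 + m) refl = refl

wn-interiorIncreasing : ∀ m → InteriorIncreasing (4 + m) (wn (4 + m))
wn-interiorIncreasing m {x} {y} 2≤x x<y y<n with x ≤? suc m | y ≤? suc m
... | yes x≤1+m | yes y≤1+m
  rewrite wn-low m 2≤x x≤1+m | wn-low m (≤-trans 2≤x (<⇒≤ x<y)) y≤1+m = ∸-monoˡ-< x<y (≤-trans (n≤1+n 1) 2≤x)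
... | yes x≤1+m | no y≰1+m
  rewrite wn-low m 2≤x x≤1+m | wn-high m (≰⇒> y≰1+m) y<n = ≤-<-trans (m∸n≤m x 1) x<y
... | no x≰1+m | yes y≤1+m = ⊥-elim (x≰1+m (≤-trans (<⇒≤ x<y) y≤1+m))
... | no x≰1+m | no y≰1+m
  rewrite wn-high m (≰⇒> x≰1+m) (<-trans x<y y<n) | wn-high m (≰⇒> y≰1+m) y<n = x<y

proposition3p1 : (n : ℕ) → 4 ≤ n → (a : List ℕ) → IsReducedWord n (wn n) a →
    ascents a ≡ 2 × descents a ≡ n ∸ 2
proposition3p1 _ (s≤s (s≤s (s≤s (s≤s (z≤n {m}))))) a (letters , agrees , len) = ascents≡2 , descents≡2+m
  where
  n = 4 + m
  2≤n : 2 ≤ n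
  2≤n = s≤s (s≤s z≤n)
  agrees′ : ∀ x → InRange n x → prod a x ≡ wn n x
  agrees′ x (1≤x , x≤n) = agrees x 1≤x x≤n
  red : Reduced n a
  red = letters , trans len (sym (inversions-cong n agrees′))
  adm : Admissible n a
  adm = red , interiorIncreasing-cong agrees′ (wn-interiorIncreasing m)
  u₁≡n : prod a 1 ≡ n
  u₁≡n = agrees′ 1 (s≤s z≤n , s≤s z≤n)
  uₙ≡1+m : prod a n ≡ suc m
  uₙ≡1+m = trans (agrees′ n (s≤s z≤n , ≤-refl)) (wn-last m)
  uₙ<u₁ : prod a n < prod a 1
  uₙ<u₁ = subst₂ _<_ (sym uₙ≡1+m) (sym u₁≡n) (s≤s (m≤n+m (suc m) 2))
  n∸uₙ≡3 : n ∸ prod a n ≡ 3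
  n∸uₙ≡3 = trans (cong (n ∸_) uₙ≡1+m) (m+n∸n≡m 3 m)
  ascents≡2 : ascents a ≡ 2
  ascents≡2 = suc-injective (trans (ascents-descending a 2≤n adm uₙ<u₁) n∸uₙ≡3)
  length≡1+n : length a ≡ suc n
  length≡1+n = suc-injective (suc-injective
    (trans (length-descending a 2≤n adm uₙ<u₁) (trans (cong₂ _+_ u₁≡n n∸uₙ≡3) (+-comm n 3))))
  descents≡2+m : descents a ≡ suc (suc m)
  descents≡2+m = suc-injective (suc-injective (trans (cong (_+ descents a) (sym ascents≡2))
    (trans (ascents+descents (reduced-linked red)) (cong (_∸ 1) length≡1+n))))
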